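{- Let $m\ge2$ and let $G=\prod_l\mathbb{Z}_l^{d_l}$ be a finite Abelian group, where $l$ runs over all prime powers. Suppose $G=[-m+1,m]^*\diamond_2 S$ for some $S\in G^n$. Then for every integer $j$ with $1\le j\le\lfloor\log_2 m\rfloor$, $$\sum_{i=1}^j i\,d_{2^i}\le 2j+2.$$
   Context: $[a,b]^*=\{a,\dots,b\}\setminus\{0\}$. For a finite Abelian group $G$, finite $M\subseteq\mathbb{Z}\setminus\{0\}$, $t\ge1$ and $S=(s_1,\dots,s_n)\in G^n$: $G\ge M\diamond_t S$ means the elements $\sum_i e_is_i$, for $\mathbf{e}\in(M\cup\{0\})^n$ with $1\le\mathrm{wt}(\mathbf{e})\le t$ (Hamming weight), are nonzero and pairwise distinct for distinct $\mathbf{e}$; $G\le M\diamond_t S$ means every $g\in G$ equals $\sum_ie_is_i$ for some $\mathbf{e}\in(M\cup\{0\})^n$ with $\mathrm{wt}(\mathbf{e})\le t$; $G=M\diamond_t S$ means both. -}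

module Defs where

open import Data.Nat as ℕ using (ℕ; zero; suc)
open import Data.Nat.Primality using (Prime)
open import Data.Integer as ℤ using (ℤ; +_)
open import Data.Integer.Divisibility using (_∣_)
open import Data.Fin using (Fin)
import Data.Fin as F
open import Data.Product using (Σ; ∃; _×_; _,_)
open import Relation.Nullary using (¬_; yes; no)
open import Relation.Binary.PropositionalEquality using (_≡_)

IsPrimePower : ℕ → Set
IsPrimePower l = Σ ℕ λ p → Σ ℕ λ e → Prime p × 1 ℕ.≤ e × l ≡ p ℕ.^ e

-- The group G = ℤ_{q 0} × … × ℤ_{q (r-1)}, each q k a prime power.
-- Elements are represented by integer vectors Fin r → ℤ;
-- two vectors denote the same group element iff they agree mod q k in every coordinate.
Elt : ℕ → Set
Elt r = Fin r → ℤ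

_≈[_]_ : {r : ℕ} → Elt r → (Fin r → ℕ) → Elt r → Set
x ≈[ q ] y = ∀ k → (+ q k) ∣ (x k ℤ.- y k)

zeroElt : {r : ℕ} → Elt r
zeroElt _ = + 0

sumℤ : {n : ℕ} → (Fin n → ℤ) → ℤ
sumℤ {zero} f = + 0
sumℤ {suc n} f = f F.zero ℤ.+ sumℤ (λ i → f (F.suc i))

lin : {n r : ℕ} → (Fin n → ℤ) → (Fin n → Elt r) → Elt r
lin e S k = sumℤ (λ i → e i ℤ.* S i k)

wt : {n : ℕ} → (Fin n → ℤ) → ℕ
wt {zero} e = 0
wt {suc n} e with e F.zero ℤ.≟ + 0
... | yes _ = wt (λ i → e (F.suc i))
... | no _ = suc (wt (λ i → e (F.suc i)))

Coeffs : ℕ → {n : ℕ} → (Fin n → ℤ) → Set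
Coeffs m e = ∀ i → ((+ 1) ℤ.- (+ m) ℤ.≤ e i) × (e i ℤ.≤ + m)

Packing : (m t : ℕ) {n r : ℕ} → (Fin r → ℕ) → (Fin n → Elt r) → Set
Packing m t q S =
  ∀ e e' → Coeffs m e → Coeffs m e' →
  1 ℕ.≤ wt e → wt e ℕ.≤ t → 1 ℕ.≤ wt e' → wt e' ℕ.≤ t →
  (¬ (lin e S ≈[ q ] zeroElt)) ×
  (lin e S ≈[ q ] lin e' S → ∀ i → e i ≡ e' i)

Covering : (m t : ℕ) {n r : ℕ} → (Fin r → ℕ) → (Fin n → Elt r) → Set
Covering m t q S =
  ∀ (g : Elt _) → ∃ λ e → Coeffs m e × wt e ℕ.≤ t × lin e S ≈[ q ] g

Perfect : (m t : ℕ) {n r : ℕ} → (Fin r → ℕ) → (Fin n → Elt r) → Set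
Perfect m t q S = Packing m t q S × Covering m t q S

mult : {r : ℕ} → (Fin r → ℕ) → ℕ → ℕ
mult {zero} q l = 0
mult {suc r} q l with q F.zero ℕ.≟ l
... | yes _ = suc (mult (λ k → q (F.suc k)) l)
... | no _ = mult (λ k → q (F.suc k)) l

sumFrom1 : ℕ → (ℕ → ℕ) → ℕ
sumFrom1 zero f = 0
sumFrom1 (suc j) f = sumFrom1 j f ℕ.+ f (suc j)

-- Put K = 2^j and let H ≤ G be the product of the cyclic factors ℤ_{2^i} with 1 ≤ i ≤ j, so that
-- |H| = 2^D with D = Σ_{i ≤ j} i·d_{2^i}, and K·H = 0. Let W be the set of the x nonzero multiples
-- of K in M = [-m+1, m]^*. For e ∈ (W ∪ {0})ⁿ of weight ≤ 2 and h ∈ H, covering writes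
-- Σ eᵢsᵢ + h = Σ e'ᵢsᵢ with e' ∈ (M ∪ {0})ⁿ of weight ≤ 2, and (e, h) ↦ e' is injective: on the
-- coordinates of H a difference Σ (e₁ - e₂)ᵢsᵢ is a multiple of K, hence zero, so h₁ = h₂, and then
-- e₁ = e₂ by packing. If N_v counts the vectors of weight ≤ 2 over v nonzero letters, this gives
-- 2^D N_x ≤ N_{2m-1}; since 2m - 1 ≤ 2K·x and N_{cv} ≤ c² N_v, 2^D ≤ (2K)² = 2^{2j+2}.

module Submission where

open import Defs
open import Data.Nat
  using (ℕ; zero; suc; _+_; _*_; _^_; _∸_; _≤_; _<_; z≤n; s≤s; s≤s⁻¹; NonZero; >-nonZero; ⌊_/2⌋; ⌈_/2⌉)
import Data.Nat.Properties as ℕ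
open import Data.Nat.DivMod using (_/_; _%_; m≡m%n+[m/n]*n; m%n<n; m≥n⇒m/n>0; m/n*n≤m)
open import Data.Nat.Divisibility as ℕ∣ using (_∣_; _∣0; >⇒∤)
open import Data.Nat.Logarithm using (⌊log₂_⌋; ⌊log₂⌊n/2⌋⌋≡⌊log₂n⌋∸1)
import Data.Nat.Tactic.RingSolver as ℕ-Ring
open import Algebra.Properties.CommutativeSemigroup ℕ.+-commutativeSemigroup
  using () renaming (interchange to +-interchange)
open import Data.Integer as ℤ using (ℤ; +_; -[1+_]; +[1+_])
import Data.Integer.Properties as ℤ
open import Data.Integer.Divisibility.Signed as Signed
  using (∣ᵤ⇒∣; ∣⇒∣ᵤ) renaming (_∣_ to _∣ℤ_)
import Data.Integer.Tactic.RingSolver as ℤ-Ring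
open import Data.Fin as Fin using (Fin; splitAt; remQuot; toℕ)
import Data.Fin.Properties as Fin
open import Data.Vec.Functional using (Vector; _∷_)
open import Data.Vec.Functional.Properties using (∷-cong)
open import Data.Vec.Functional.Relation.Unary.All using (All)
open import Data.Product using (∃; _×_; _,_; proj₁; proj₂)
open import Data.Sum using (_⊎_; inj₁; inj₂; [_,_]′)
open import Data.Sum.Function.Propositional using (_⊎-↔_)
open import Function using (_∘_; Injective)
open import Function.Bundles using (Inverse; Injection; _↔_)
open import Function.Properties.Inverse using (↔⇒↣)
open import Function.Construct.Composition using (_↔-∘_)
open import Function.Construct.Identity using (↔-id)
open import Relation.Nullary using (Dec; yes; no; contradiction)
open import Relation.Binary.PropositionalEquality
  using (_≡_; _≢_; _≗_; refl; sym; trans; cong; cong₂; subst; module ≡-Reasoning)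

module _ {r : ℕ} {q : Fin r → ℕ} where

  ≈-reflexive : {x y : Elt r} → x ≗ y → x ≈[ q ] y
  ≈-reflexive {x} {y} x≗y k = subst (λ z → q k ∣ ℤ.∣ z ∣) (sym (ℤ.i≡j⇒i-j≡0 (x≗y k))) (q k ∣0)

  ≈-sym : {x y : Elt r} → x ≈[ q ] y → y ≈[ q ] x
  ≈-sym {x} {y} x≈y k = subst (q k ∣_) (ℤ.∣i-j∣≡∣j-i∣ (x k) (y k)) (x≈y k)

  ≈-trans : {x y z : Elt r} → x ≈[ q ] y → y ≈[ q ] z → x ≈[ q ] z
  ≈-trans {x} {y} {z} x≈y y≈z k = ∣⇒∣ᵤ (subst (+ q k ∣ℤ_) (ℤ.+-minus-telescope (x k) (y k) (z k))
    (Signed.∣m∣n⇒∣m+n (∣ᵤ⇒∣ {i = x k ℤ.- y k} (x≈y k)) (∣ᵤ⇒∣ {i = y k ℤ.- z k} (y≈z k))))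

_∣ℤ0 : ∀ d → d ∣ℤ + 0
d ∣ℤ0 = Signed.divides (+ 0) (sym (ℤ.*-zeroˡ d))

sumℤ-zero : ∀ {n} {f : Fin n → ℤ} → (∀ i → f i ≡ + 0) → sumℤ f ≡ + 0
sumℤ-zero {zero} f≡0 = refl
sumℤ-zero {suc n} f≡0 = cong₂ ℤ._+_ (f≡0 Fin.zero) (sumℤ-zero (f≡0 ∘ Fin.suc))

sumℤ-cong : ∀ {n} {f g : Fin n → ℤ} → f ≗ g → sumℤ f ≡ sumℤ g
sumℤ-cong {zero}  f≗g = refl
sumℤ-cong {suc n} f≗g = cong₂ ℤ._+_ (f≗g Fin.zero) (sumℤ-cong (f≗g ∘ Fin.suc))

sumℤ-divisible : ∀ {n} {d : ℤ} {f : Fin n → ℤ} → (∀ i → d ∣ℤ f i) → d ∣ℤ sumℤ f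
sumℤ-divisible {zero} {d} d∣f = d ∣ℤ0
sumℤ-divisible {suc n} d∣f = Signed.∣m∣n⇒∣m+n (d∣f Fin.zero) (sumℤ-divisible (d∣f ∘ Fin.suc))

module _ {n r : ℕ} (S : Fin n → Elt r) where

  lin-zero : {e : Fin n → ℤ} → (∀ i → e i ≡ + 0) → lin e S ≗ zeroElt
  lin-zero {e} e≡0 k = sumℤ-zero (λ i → trans (cong (ℤ._* S i k) (e≡0 i)) (ℤ.*-zeroˡ (S i k)))

  lin-cong : {e e' : Fin n → ℤ} → e ≗ e' → lin e S ≗ lin e' S
  lin-cong e≗e' k = sumℤ-cong (λ i → cong (ℤ._* S i k) (e≗e' i))

  lin-divisible : {d : ℤ} {e : Fin n → ℤ} → (∀ i → d ∣ℤ e i) → ∀ k → d ∣ℤ lin e S k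
  lin-divisible d∣e k = sumℤ-divisible (λ i → Signed.∣m⇒∣m*n (S i k) (d∣e i))

∣∧<⇒≡0 : ∀ {β d} → β ∣ d → d < β → d ≡ 0
∣∧<⇒≡0 {d = zero}  _   _   = refl
∣∧<⇒≡0 {d = suc _} β∣d d<β = contradiction β∣d (>⇒∤ d<β)

∣-difference⇒≡ : ∀ {β t t'} → t < β → t' < β → + β ∣ℤ + t ℤ.- + t' → t ≡ t'
∣-difference⇒≡ {β} {t} {t'} t<β t'<β β∣t-t' = [
    (λ t≤t' → ℕ.≤-antisym t≤t' (ordered t≤t' t'<β β∣ᵤt-t')) ,
    (λ t'≤t → sym (ℕ.≤-antisym t'≤t (ordered t'≤t t<β β∣ᵤt'-t))) ]′
  (ℕ.≤-total t t')
  where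
  β∣ᵤt-t' : β ∣ ℤ.∣ + t ℤ.- + t' ∣
  β∣ᵤt-t' = ∣⇒∣ᵤ β∣t-t'
  β∣ᵤt'-t : β ∣ ℤ.∣ + t' ℤ.- + t ∣
  β∣ᵤt'-t = subst (β ∣_) (ℤ.∣i-j∣≡∣j-i∣ (+ t) (+ t')) β∣ᵤt-t'
  ordered : ∀ {u v} → u ≤ v → v < β → β ∣ ℤ.∣ + u ℤ.- + v ∣ → v ≤ u
  ordered {u} {v} u≤v v<β β∣u-v = ℕ.m∸n≡0⇒m≤n
    (∣∧<⇒≡0 (subst (β ∣_) (trans (cong ℤ.∣_∣ (ℤ.[+m]-[+n]≡m⊖n u v)) (ℤ.∣⊖∣-≤ u≤v)) β∣u-v)
                      (ℕ.≤-<-trans (ℕ.m∸n≤m v u) v<β))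

shifted-congruence : ∀ {β q t t'} {x x' : ℤ} → β ∣ q → + β ∣ℤ x ℤ.- x' → t < β → t' < β →
  + q ∣ℤ (x ℤ.+ + t) ℤ.- (x' ℤ.+ + t') → t ≡ t' × + q ∣ℤ x ℤ.- x'
shifted-congruence {β} {q} {t} {t'} {x} {x'} β∣q β∣x-x' t<β t'<β q∣ = t≡t' , q∣x-x'
  where
  regroup : ∀ a b c d → (a ℤ.+ c) ℤ.- (b ℤ.+ d) ≡ (a ℤ.- b) ℤ.+ (c ℤ.- d)
  regroup = ℤ-Ring.solve-∀
  q∣sum : + q ∣ℤ (x ℤ.- x') ℤ.+ (+ t ℤ.- + t')
  q∣sum = subst (+ q ∣ℤ_) (regroup x x' (+ t) (+ t')) q∣
  t≡t' : t ≡ t'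
  t≡t' = ∣-difference⇒≡ t<β t'<β
    (Signed.∣m+n∣m⇒∣n (Signed.∣-trans (∣ᵤ⇒∣ β∣q) q∣sum) β∣x-x')
  q∣x-x' : + q ∣ℤ x ℤ.- x'
  q∣x-x' = Signed.∣m+n∣n⇒∣m q∣sum
    (subst (+ q ∣ℤ_) (sym (ℤ.i≡j⇒i-j≡0 (cong +_ t≡t'))) ((+ q) ∣ℤ0))

zero⊎weight≥1 : ∀ {n} (e : Fin n → ℤ) → (∀ i → e i ≡ + 0) ⊎ 1 ≤ wt e
zero⊎weight≥1 {zero} e = inj₁ λ ()
zero⊎weight≥1 {suc n} e with e Fin.zero ℤ.≟ + 0 | zero⊎weight≥1 (e ∘ Fin.suc)
... | yes e₀≡0 | inj₁ e₊≡0 = inj₁ λ { Fin.zero → e₀≡0 ; (Fin.suc i) → e₊≡0 i }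
... | yes _    | inj₂ 1≤wt = inj₂ 1≤wt
... | no _     | _         = inj₂ (s≤s z≤n)

wt≤0⇒zero : ∀ {n} {e : Fin n → ℤ} → wt e ≤ 0 → ∀ i → e i ≡ + 0
wt≤0⇒zero {e = e} wt≤0 with zero⊎weight≥1 e
... | inj₁ e≡0 = e≡0
... | inj₂ 1≤w = contradiction (ℕ.≤-trans 1≤w wt≤0) λ ()

wt-zero : ∀ n → wt {n} (λ _ → + 0) ≡ 0
wt-zero zero = refl
wt-zero (suc n) = wt-zero n

wt-∷ : ∀ {n c} {e : Vector ℤ n} → c ≢ + 0 → wt (c ∷ e) ≡ suc (wt e)
wt-∷ {c = c} c≢0 with c ℤ.≟ + 0
... | yes c≡0 = contradiction c≡0 c≢0
... | no _    = refl

packing-injective : ∀ {m t n r} {q : Fin r → ℕ} {S : Fin n → Elt r} → Packing m t q S →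
  ∀ {e e'} → Coeffs m e → Coeffs m e' → wt e ≤ t → wt e' ≤ t →
  lin e S ≈[ q ] lin e' S → e ≗ e'
packing-injective {q = q} {S} packing {e} {e'} c c' w w' eq
  with zero⊎weight≥1 e | zero⊎weight≥1 e'
... | inj₁ e≡0 | inj₁ e'≡0 = λ i → trans (e≡0 i) (sym (e'≡0 i))
... | inj₁ e≡0 | inj₂ 1≤w' = contradiction e'≈0 (proj₁ (packing e' e' c' c' 1≤w' w' 1≤w' w'))
  where
  e'≈0 : lin e' S ≈[ q ] zeroElt
  e'≈0 = ≈-trans {x = lin e' S} {z = zeroElt} (≈-sym {x = lin e S} eq) (≈-reflexive (lin-zero S e≡0))
... | inj₂ 1≤w | inj₁ e'≡0 = contradiction e≈0 (proj₁ (packing e e c c 1≤w w 1≤w w))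
  where
  e≈0 : lin e S ≈[ q ] zeroElt
  e≈0 = ≈-trans {x = lin e S} {z = zeroElt} eq (≈-reflexive (lin-zero S e'≡0))
... | inj₂ 1≤w | inj₂ 1≤w' = proj₂ (packing e e' c c' 1≤w w 1≤w' w') eq

-- The number of vectors in ({0} ∪ V)ⁿ with at most w nonzero entries, where |V| = v.
ballSize : ℕ → ℕ → ℕ → ℕ
ballSize v zero    w       = 1
ballSize v (suc n) zero    = 1
ballSize v (suc n) (suc w) = ballSize v n (suc w) + v * ballSize v n w

ballSplit : ∀ {v} n w →
  Fin (ballSize v (suc n) (suc w)) ↔ (Fin (ballSize v n (suc w)) ⊎ (Fin v × Fin (ballSize v n w)))
ballSplit n w = (↔-id _ ⊎-↔ Fin.*↔×) ↔-∘ Fin.+↔⊎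

module _ {v : ℕ} (V : Fin v → ℤ) where

  ball : ∀ n w → Fin (ballSize v n w) → Vector ℤ n
  ball-step : ∀ n w → Fin (ballSize v n (suc w)) ⊎ (Fin v × Fin (ballSize v n w)) → Vector ℤ (suc n)

  ball zero    w       _ = λ ()
  ball (suc n) zero    _ = λ _ → + 0
  ball (suc n) (suc w) i = ball-step n w (Inverse.to (ballSplit n w) i)

  ball-step n w (inj₁ i)       = + 0 ∷ ball n (suc w) i
  ball-step n w (inj₂ (p , i)) = V p ∷ ball n w i

  module _ (P : ℤ → Set) (P0 : P (+ 0)) (PV : ∀ p → P (V p)) where

    ball-entries : ∀ n w i → All P (ball n w i)
    ball-step-entries : ∀ n w u → All P (ball-step n w u)

    ball-entries (suc n) zero    i _ = P0
    ball-entries (suc n) (suc w) i   = ball-step-entries n w (Inverse.to (ballSplit n w) i)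

    ball-step-entries n w (inj₁ i)       Fin.zero    = P0
    ball-step-entries n w (inj₁ i)       (Fin.suc k) = ball-entries n (suc w) i k
    ball-step-entries n w (inj₂ (p , i)) Fin.zero    = PV p
    ball-step-entries n w (inj₂ (p , i)) (Fin.suc k) = ball-entries n w i k

  module _ (V≢0 : ∀ p → V p ≢ + 0) where

    ball-wt : ∀ n w i → wt (ball n w i) ≤ w
    ball-step-wt : ∀ n w u → wt (ball-step n w u) ≤ suc w

    ball-wt zero    w       i = z≤n
    ball-wt (suc n) zero    i = ℕ.≤-reflexive (wt-zero (suc n))
    ball-wt (suc n) (suc w) i = ball-step-wt n w (Inverse.to (ballSplit n w) i)

    ball-step-wt n w (inj₁ i)       = ball-wt n (suc w) i
    ball-step-wt n w (inj₂ (p , i)) = subst (_≤ suc w) (sym (wt-∷ (V≢0 p))) (s≤s (ball-wt n w i))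

    module _ (V-injective : Injective _≡_ _≡_ V) where

      ball-injective : ∀ n w {i i'} → ball n w i ≗ ball n w i' → i ≡ i'
      ball-step-injective : ∀ n w {u u'} → ball-step n w u ≗ ball-step n w u' → u ≡ u'

      ball-injective zero    w       {Fin.zero} {Fin.zero} _ = refl
      ball-injective (suc n) zero    {Fin.zero} {Fin.zero} _ = refl
      ball-injective (suc n) (suc w) eq =
        Injection.injective (↔⇒↣ (ballSplit n w)) (ball-step-injective n w eq)

      ball-step-injective n w {inj₁ i} {inj₁ i'} eq =
        cong inj₁ (ball-injective n (suc w) (eq ∘ Fin.suc))
      ball-step-injective n w {inj₁ i} {inj₂ (p' , i')} eq = contradiction (sym (eq Fin.zero)) (V≢0 p')
      ball-step-injective n w {inj₂ (p , i)} {inj₁ i'} eq = contradiction (eq Fin.zero) (V≢0 p)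
      ball-step-injective n w {inj₂ (p , i)} {inj₂ (p' , i')} eq =
        cong inj₂ (cong₂ _,_ (V-injective (eq Fin.zero)) (ball-injective n w (eq ∘ Fin.suc)))

  from-ball-step : ∀ {n w} u {e} → ball-step n w u ≗ e → ∃ λ i → ball (suc n) (suc w) i ≗ e
  from-ball-step {n} {w} u eq = Inverse.from (ballSplit n w) u , λ k →
    trans (cong (λ u → ball-step n w u k) (Inverse.strictlyInverseˡ (ballSplit n w) u)) (eq k)

  module _ (P : ℤ → Set) (V-onto : ∀ c → P c → c ≢ + 0 → ∃ λ p → V p ≡ c) where

    ball-complete : ∀ n w (e : Vector ℤ n) → All P e → wt e ≤ w → ∃ λ i → ball n w i ≗ e
    ball-complete zero    w       e _  _   = Fin.zero , λ ()
    ball-complete (suc n) zero    e _  wt≤ = Fin.zero , λ k → sym (wt≤0⇒zero {e = e} wt≤ k)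
    ball-complete (suc n) (suc w) e Pe wt≤ with e Fin.zero ℤ.≟ + 0
    ... | yes e₀≡0 = let i , eq = ball-complete n (suc w) (e ∘ Fin.suc) (Pe ∘ Fin.suc) wt≤ in
      from-ball-step (inj₁ i) (∷-cong (sym e₀≡0) eq)
    ... | no e₀≢0 = let i , eq = ball-complete n w (e ∘ Fin.suc) (Pe ∘ Fin.suc) (s≤s⁻¹ wt≤)
                        p , Vp≡e₀ = V-onto (e Fin.zero) (Pe Fin.zero) e₀≢0 in
      from-ball-step (inj₂ (p , i)) (∷-cong Vp≡e₀ eq)

ballSize-positive : ∀ v n w → 1 ≤ ballSize v n w
ballSize-positive v zero    w       = s≤s z≤n
ballSize-positive v (suc n) zero    = s≤s z≤n
ballSize-positive v (suc n) (suc w) = ℕ.≤-trans (ballSize-positive v n (suc w)) (ℕ.m≤m+n _ _)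

ballSize-monoˡ-≤ : ∀ {v v'} n w → v ≤ v' → ballSize v n w ≤ ballSize v' n w
ballSize-monoˡ-≤ zero    w       v≤v' = ℕ.≤-refl
ballSize-monoˡ-≤ (suc n) zero    v≤v' = ℕ.≤-refl
ballSize-monoˡ-≤ (suc n) (suc w) v≤v' =
  ℕ.+-mono-≤ (ballSize-monoˡ-≤ n (suc w) v≤v') (ℕ.*-mono-≤ v≤v' (ballSize-monoˡ-≤ n w v≤v'))

ballSize-scale : ∀ c .{{_ : NonZero c}} v n w → ballSize (c * v) n w ≤ c ^ w * ballSize v n w
ballSize-scale c v zero    w       = ℕ.≤-trans (ℕ.m^n>0 c w) (ℕ.≤-reflexive (sym (ℕ.*-identityʳ _)))
ballSize-scale c v (suc n) zero    = ℕ.≤-refl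
ballSize-scale c v (suc n) (suc w) = begin
  ballSize (c * v) n (suc w) + c * v * ballSize (c * v) n w
    ≤⟨ ℕ.+-mono-≤ (ballSize-scale c v n (suc w)) (ℕ.*-monoʳ-≤ (c * v) (ballSize-scale c v n w)) ⟩
  c * c ^ w * ballSize v n (suc w) + c * v * (c ^ w * ballSize v n w)
    ≡⟨ factor c (c ^ w) (ballSize v n (suc w)) v (ballSize v n w) ⟩
  c * c ^ w * (ballSize v n (suc w) + v * ballSize v n w) ∎
  where
  open ℕ.≤-Reasoning
  factor : ∀ c p b₁ v b₀ → c * p * b₁ + c * v * (p * b₀) ≡ c * p * (b₁ + v * b₀)
  factor = ℕ-Ring.solve-∀

ballSize-ratio : ∀ {x u c P} n w .{{_ : NonZero c}} →
  u ≤ c * x → ballSize x n w * P ≤ ballSize u n w → P ≤ c ^ w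
ballSize-ratio {x} {u} {c} {P} n w u≤cx count =
  ℕ.*-cancelʳ-≤ P (c ^ w) (ballSize x n w) {{>-nonZero (ballSize-positive x n w)}} (begin
    P * ballSize x n w       ≡⟨ ℕ.*-comm P _ ⟩
    ballSize x n w * P       ≤⟨ count ⟩
    ballSize u n w           ≤⟨ ballSize-monoˡ-≤ n w u≤cx ⟩
    ballSize (c * x) n w     ≤⟨ ballSize-scale c x n w ⟩
    c ^ w * ballSize x n w   ∎)
  where open ℕ.≤-Reasoning

∏ : ∀ {r} → (Fin r → ℕ) → ℕ
∏ {zero}  b = 1
∏ {suc r} b = b Fin.zero * ∏ (b ∘ Fin.suc)

digits : ∀ {r} (b : Fin r → ℕ) → Fin (∏ b) → (k : Fin r) → Fin (b k)
digits {suc r} b i Fin.zero    = proj₁ (remQuot {b Fin.zero} (∏ (b ∘ Fin.suc)) i)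
digits {suc r} b i (Fin.suc k) = digits (b ∘ Fin.suc) (proj₂ (remQuot {b Fin.zero} (∏ (b ∘ Fin.suc)) i)) k

digits-injective : ∀ {r} (b : Fin r → ℕ) {i i'} → (∀ k → digits b i k ≡ digits b i' k) → i ≡ i'
digits-injective {zero}  b {Fin.zero} {Fin.zero} _ = refl
digits-injective {suc r} b eq = Injection.injective (↔⇒↣ (Fin.*↔× {b Fin.zero}))
  (cong₂ _,_ (eq Fin.zero) (digits-injective (b ∘ Fin.suc) (eq ∘ Fin.suc)))

^-cancelʳ-≤ : ∀ m {a b} → 1 < m → m ^ a ≤ m ^ b → a ≤ b
^-cancelʳ-≤ m {a} {b} 1<m mᵃ≤mᵇ with a ℕ.≤? b
... | yes a≤b = a≤b
... | no  a≰b = contradiction mᵃ≤mᵇ (ℕ.<⇒≱ (ℕ.^-monoʳ-< m 1<m (ℕ.≰⇒> a≰b)))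

^-monoʳ-∣ : ∀ m {a b} → a ≤ b → m ^ a ∣ m ^ b
^-monoʳ-∣ m {a} {b} a≤b = subst (m ^ a ∣_) mᵃ⁺⁽ᵇ⁻ᵃ⁾≡mᵇ (ℕ∣.m∣m*n (m ^ (b ∸ a)))
  where
  mᵃ⁺⁽ᵇ⁻ᵃ⁾≡mᵇ : m ^ a * m ^ (b ∸ a) ≡ m ^ b
  mᵃ⁺⁽ᵇ⁻ᵃ⁾≡mᵇ = trans (sym (ℕ.^-distribˡ-+-* m a (b ∸ a))) (cong (m ^_) (ℕ.m+[n∸m]≡n a≤b))

[2*2^j]²≡2^[2j+2] : ∀ j → (2 * 2 ^ j) ^ 2 ≡ 2 ^ (2 * j + 2)
[2*2^j]²≡2^[2j+2] j = trans (ℕ.^-*-assoc 2 (suc j) 2) (cong (2 ^_) (double-suc j))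
  where
  double-suc : ∀ j → suc j * 2 ≡ 2 * j + 2
  double-suc = ℕ-Ring.solve-∀

≤⌊log₂⌋⇒2^≤ : ∀ j m → j ≤ ⌊log₂ m ⌋ → 1 ≤ m → 2 ^ j ≤ m
≤⌊log₂⌋⇒2^≤ zero    m             _     1≤m = 1≤m
≤⌊log₂⌋⇒2^≤ (suc j) (suc (suc m)) j<log _   = begin
  2 * 2 ^ j               ≤⟨ ℕ.*-monoʳ-≤ 2 (≤⌊log₂⌋⇒2^≤ j (suc ⌊ m /2⌋) j≤log (s≤s z≤n)) ⟩
  2 * suc ⌊ m /2⌋         ≤⟨ twice-half (suc (suc m)) ⟩
  suc (suc m)             ∎
  where
  open ℕ.≤-Reasoning
  j≤log : j ≤ ⌊log₂ suc ⌊ m /2⌋ ⌋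
  j≤log = subst (j ≤_) (sym (⌊log₂⌊n/2⌋⌋≡⌊log₂n⌋∸1 (suc (suc m)))) (ℕ.∸-monoˡ-≤ 1 j<log)
  twice-half : ∀ n → 2 * ⌊ n /2⌋ ≤ n
  twice-half n = begin
    2 * ⌊ n /2⌋          ≡⟨ cong (_+_ ⌊ n /2⌋) (ℕ.+-identityʳ _) ⟩
    ⌊ n /2⌋ + ⌊ n /2⌋    ≤⟨ ℕ.+-monoʳ-≤ ⌊ n /2⌋ (ℕ.⌊n/2⌋≤⌈n/2⌉ n) ⟩
    ⌊ n /2⌋ + ⌈ n /2⌉    ≡⟨ ℕ.⌊n/2⌋+⌈n/2⌉≡n n ⟩
    n                    ∎

multiples-cover : ∀ m K .{{_ : NonZero K}} → K ≤ m → m + (m ∸ 1) ≤ 2 * K * (m / K + (m ∸ 1) / K)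
multiples-cover m K K≤m = begin
  m + (m ∸ 1)                       ≤⟨ ℕ.+-monoʳ-≤ m (ℕ.m∸n≤m m 1) ⟩
  m + m                             ≡⟨ cong (_+_ m) (ℕ.+-identityʳ m) ⟨
  2 * m                             ≤⟨ ℕ.*-monoʳ-≤ 2 (cover (m≥n⇒m/n>0 K≤m) (below-next m) m≤[1+b]K) ⟩
  2 * (K * (m / K + (m ∸ 1) / K))   ≡⟨ ℕ.*-assoc 2 K _ ⟨
  2 * K * (m / K + (m ∸ 1) / K)     ∎
  where
  open ℕ.≤-Reasoning
  below-next : ∀ x → x < suc (x / K) * K
  below-next x = begin-strict
    x                  ≡⟨ m≡m%n+[m/n]*n x K ⟩
    x % K + x / K * K  <⟨ ℕ.+-monoˡ-< (x / K * K) (m%n<n x K) ⟩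
    K + x / K * K      ∎
  m≤[1+b]K : m ≤ suc ((m ∸ 1) / K) * K
  m≤[1+b]K = ℕ.≤-trans (ℕ.m≤n+m∸n m 1) (below-next (m ∸ 1))
  doubling : ∀ {x} → 1 ≤ x → suc x ≤ x + x
  doubling {x} 1≤x = ℕ.+-monoˡ-≤ x 1≤x
  regroup : ∀ a b K → (a + a) * K + (b + b) * K ≡ 2 * (K * (a + b))
  regroup = ℕ-Ring.solve-∀
  cover : ∀ {a b} → 1 ≤ a → m < suc a * K → m ≤ suc b * K → m ≤ K * (a + b)
  cover {a} {zero} 1≤a _ m≤K = begin
    m            ≤⟨ m≤K ⟩
    1 * K        ≤⟨ ℕ.*-monoˡ-≤ K 1≤a ⟩
    a * K        ≡⟨ ℕ.*-comm a K ⟩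
    K * a        ≡⟨ cong (K *_) (ℕ.+-identityʳ a) ⟨
    K * (a + 0)  ∎
  cover {a} {b@(suc _)} 1≤a m<[1+a]K m≤[1+b]K = ℕ.*-cancelˡ-≤ 2 (begin
    2 * m                          ≡⟨ cong (_+_ m) (ℕ.+-identityʳ m) ⟩
    m + m                          ≤⟨ ℕ.+-mono-≤ (ℕ.<⇒≤ m<[1+a]K) m≤[1+b]K ⟩
    suc a * K + suc b * K
      ≤⟨ ℕ.+-mono-≤ (ℕ.*-monoˡ-≤ K (doubling 1≤a)) (ℕ.*-monoˡ-≤ K (doubling {b} (s≤s z≤n))) ⟩
    (a + a) * K + (b + b) * K      ≡⟨ regroup a b K ⟩
    2 * (K * (a + b))              ∎)

sumFrom1-cong : ∀ j {f g : ℕ → ℕ} → (∀ i → f i ≡ g i) → sumFrom1 j f ≡ sumFrom1 j g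
sumFrom1-cong zero    f≡g = refl
sumFrom1-cong (suc j) f≡g = cong₂ _+_ (sumFrom1-cong j f≡g) (f≡g (suc j))

sumFrom1-+ : ∀ j (f g : ℕ → ℕ) → sumFrom1 j (λ i → f i + g i) ≡ sumFrom1 j f + sumFrom1 j g
sumFrom1-+ zero    f g = refl
sumFrom1-+ (suc j) f g = begin
  sumFrom1 j (λ i → f i + g i) + (f (suc j) + g (suc j))
    ≡⟨ cong (_+ (f (suc j) + g (suc j))) (sumFrom1-+ j f g) ⟩
  sumFrom1 j f + sumFrom1 j g + (f (suc j) + g (suc j))
    ≡⟨ +-interchange (sumFrom1 j f) _ _ _ ⟩
  sumFrom1 j f + f (suc j) + (sumFrom1 j g + g (suc j))
    ∎
  where open ≡-Reasoning

mult-single-≡ : ∀ {a l} → a ≡ l → mult (λ (_ : Fin 1) → a) l ≡ 1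
mult-single-≡ {a} {l} a≡l with a ℕ.≟ l
... | yes _   = refl
... | no  a≢l = contradiction a≡l a≢l

mult-single-≢ : ∀ {a l} → a ≢ l → mult (λ (_ : Fin 1) → a) l ≡ 0
mult-single-≢ {a} {l} a≢l with a ℕ.≟ l
... | yes a≡l = contradiction a≡l a≢l
... | no  _   = refl

mult-split : ∀ {r} (q : Fin (suc r) → ℕ) l →
  mult q l ≡ mult (λ (_ : Fin 1) → q Fin.zero) l + mult (q ∘ Fin.suc) l
mult-split q l with q Fin.zero ℕ.≟ l
... | yes _ = refl
... | no  _ = refl

dyadicRank : ℕ → ∀ {r} → (Fin r → ℕ) → ℕ
dyadicRank j q = sumFrom1 j (λ i → i * mult q (2 ^ i))

dyadicExponent : ℕ → ℕ → ℕ
dyadicExponent j a = dyadicRank j (λ (_ : Fin 1) → a)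

dyadicExponent-spec : ∀ j a → dyadicExponent j a ≡ 0 ⊎ (dyadicExponent j a ≤ j × a ≡ 2 ^ dyadicExponent j a)
dyadicExponent-spec zero    a = inj₁ refl
dyadicExponent-spec (suc j) a = step (a ℕ.≟ 2 ^ suc j) (dyadicExponent-spec j a)
  where
  e = dyadicExponent j a
  e′ = dyadicExponent (suc j) a
  Spec : ℕ → ℕ → Set
  Spec i d = d ≡ 0 ⊎ (d ≤ i × a ≡ 2 ^ d)
  step : Dec (a ≡ 2 ^ suc j) → Spec j e → Spec (suc j) e′
  step (yes a≡2^[1+j]) (inj₁ e≡0) =
    inj₂ (ℕ.≤-reflexive e′≡1+j , trans a≡2^[1+j] (cong (2 ^_) (sym e′≡1+j)))
    where
    e′≡1+j : e′ ≡ suc j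
    e′≡1+j = trans (cong₂ _+_ e≡0 (cong (suc j *_) (mult-single-≡ a≡2^[1+j]))) (ℕ.*-identityʳ (suc j))
  step (yes a≡2^[1+j]) (inj₂ (e≤j , a≡2^e)) =
    contradiction (trans (sym a≡2^e) a≡2^[1+j]) (ℕ.<⇒≢ (ℕ.^-monoʳ-< 2 (s≤s (s≤s z≤n)) (s≤s e≤j)))
  step (no a≢2^[1+j]) spec = subst (Spec (suc j)) (sym e′≡e) (weaken spec)
    where
    e′≡e : e′ ≡ e
    e′≡e = trans (cong (_+_ e) (trans (cong (suc j *_) (mult-single-≢ a≢2^[1+j])) (ℕ.*-zeroʳ (suc j))))
                 (ℕ.+-identityʳ e)
    weaken : Spec j e → Spec (suc j) e
    weaken (inj₁ e≡0)           = inj₁ e≡0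
    weaken (inj₂ (e≤j , a≡2^e)) = inj₂ (ℕ.m≤n⇒m≤1+n e≤j , a≡2^e)

-- The order of the factor of H inside ℤ_a: a itself when a = 2^i with 1 ≤ i ≤ j, and 1 otherwise.
dyadicPart : ℕ → ℕ → ℕ
dyadicPart j a = 2 ^ dyadicExponent j a

dyadicPart∣ : ∀ j a → dyadicPart j a ∣ a
dyadicPart∣ j a with dyadicExponent-spec j a
... | inj₁ e≡0         = subst (λ e → 2 ^ e ∣ a) (sym e≡0) (ℕ∣.1∣ a)
... | inj₂ (_ , a≡2^e) = subst (dyadicPart j a ∣_) (sym a≡2^e) ℕ∣.∣-refl

dyadicPart∣2^ : ∀ j a → dyadicPart j a ∣ 2 ^ j
dyadicPart∣2^ j a with dyadicExponent-spec j a
... | inj₁ e≡0     = subst (λ e → 2 ^ e ∣ 2 ^ j) (sym e≡0) (ℕ∣.1∣ (2 ^ j))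
... | inj₂ (e≤j , _) = ^-monoʳ-∣ 2 e≤j

dyadicRank-empty : ∀ j (q : Fin 0 → ℕ) → dyadicRank j q ≡ 0
dyadicRank-empty zero    q = refl
dyadicRank-empty (suc j) q = cong₂ _+_ (dyadicRank-empty j q) (ℕ.*-zeroʳ (suc j))

dyadicRank-split : ∀ j {r} (q : Fin (suc r) → ℕ) →
  dyadicRank j q ≡ dyadicExponent j (q Fin.zero) + dyadicRank j (q ∘ Fin.suc)
dyadicRank-split j q = trans
  (sumFrom1-cong j (λ i → trans (cong (i *_) (mult-split q (2 ^ i))) (ℕ.*-distribˡ-+ i _ _)))
  (sumFrom1-+ j (λ i → i * mult (λ (_ : Fin 1) → q Fin.zero) (2 ^ i)) (λ i → i * mult (q ∘ Fin.suc) (2 ^ i)))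

2^dyadicRank≡∏ : ∀ j {r} (q : Fin r → ℕ) → 2 ^ dyadicRank j q ≡ ∏ (dyadicPart j ∘ q)
2^dyadicRank≡∏ j {zero}  q = cong (2 ^_) (dyadicRank-empty j q)
2^dyadicRank≡∏ j {suc r} q = begin
  2 ^ dyadicRank j q
    ≡⟨ cong (2 ^_) (dyadicRank-split j q) ⟩
  2 ^ (dyadicExponent j (q Fin.zero) + dyadicRank j (q ∘ Fin.suc))
    ≡⟨ ℕ.^-distribˡ-+-* 2 (dyadicExponent j (q Fin.zero)) _ ⟩
  dyadicPart j (q Fin.zero) * 2 ^ dyadicRank j (q ∘ Fin.suc)
    ≡⟨ cong (dyadicPart j (q Fin.zero) *_) (2^dyadicRank≡∏ j (q ∘ Fin.suc)) ⟩
  dyadicPart j (q Fin.zero) * ∏ (dyadicPart j ∘ q ∘ Fin.suc)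
    ∎
  where open ≡-Reasoning

InRange : ℕ → ℤ → Set
InRange m c = (+ 1 ℤ.- + m ℤ.≤ c) × (c ℤ.≤ + m)

1-m≡-[m∸1] : ∀ m .{{_ : NonZero m}} → + 1 ℤ.- + m ≡ ℤ.- + (m ∸ 1)
1-m≡-[m∸1] (suc zero)    = refl
1-m≡-[m∸1] (suc (suc m)) = refl

0-inRange : ∀ m .{{_ : NonZero m}} → InRange m (+ 0)
0-inRange m = subst (ℤ._≤ + 0) (sym (1-m≡-[m∸1] m)) ℤ.neg-≤-pos , ℤ.+≤+ z≤n

-- s, 2s, …, as and -s, -2s, …, -bs; for s = 1, a = m and b = m ∸ 1 these are the elements of M.
signedMultiple : ∀ {a b} → ℕ → Fin a ⊎ Fin b → ℤ
signedMultiple s (inj₁ x) = + (suc (toℕ x) * s)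
signedMultiple s (inj₂ y) = ℤ.- + (suc (toℕ y) * s)

signedMultiples : ℕ → ∀ a b → Fin (a + b) → ℤ
signedMultiples s a b = signedMultiple s ∘ splitAt a

magnitude-injective : ∀ {n} s .{{_ : NonZero s}} {x x' : Fin n} → suc (toℕ x) * s ≡ suc (toℕ x') * s → x ≡ x'
magnitude-injective s eq = Fin.toℕ-injective (ℕ.suc-injective (ℕ.*-cancelʳ-≡ _ _ s eq))

module _ {a b : ℕ} where

  signedMultiple-≢0 : ∀ s .{{_ : NonZero s}} u → signedMultiple {a} {b} s u ≢ + 0
  signedMultiple-≢0 (suc _) (inj₁ x) ()
  signedMultiple-≢0 (suc _) (inj₂ y) ()

  signedMultiple-injective : ∀ s .{{_ : NonZero s}} → Injective _≡_ _≡_ (signedMultiple {a} {b} s)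
  signedMultiple-injective s@(suc _) {inj₁ x} {inj₁ x'} eq = cong inj₁ (magnitude-injective s (ℤ.+-injective eq))
  signedMultiple-injective s@(suc _) {inj₂ y} {inj₂ y'} eq =
    cong inj₂ (magnitude-injective s (ℤ.+-injective (ℤ.neg-injective eq)))
  signedMultiple-injective (suc _) {inj₁ _} {inj₂ _} ()
  signedMultiple-injective (suc _) {inj₂ _} {inj₁ _} ()

  signedMultiple-divisible : ∀ s u → + s ∣ℤ signedMultiple {a} {b} s u
  signedMultiple-divisible s (inj₁ x) = Signed.divides (+ suc (toℕ x)) (ℤ.pos-* (suc (toℕ x)) s)
  signedMultiple-divisible s (inj₂ y) =
    Signed.∣m⇒∣-m (Signed.divides (+ suc (toℕ y)) (ℤ.pos-* (suc (toℕ y)) s))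

  signedMultiple-inRange : ∀ {m} .{{_ : NonZero m}} s → a * s ≤ m → b * s ≤ m ∸ 1 →
    ∀ u → InRange m (signedMultiple {a} {b} s u)
  signedMultiple-inRange {m} s as≤m bs≤m-1 (inj₁ x) =
    subst (ℤ._≤ _) (sym (1-m≡-[m∸1] m)) ℤ.neg-≤-pos ,
    ℤ.+≤+ (ℕ.≤-trans (ℕ.*-monoˡ-≤ s (Fin.toℕ<n x)) as≤m)
  signedMultiple-inRange {m} s as≤m bs≤m-1 (inj₂ y) =
    subst (ℤ._≤ _) (sym (1-m≡-[m∸1] m))
      (ℤ.neg-mono-≤ (ℤ.+≤+ (ℕ.≤-trans (ℕ.*-monoˡ-≤ s (Fin.toℕ<n y)) bs≤m-1))) ,
    ℤ.neg-≤-pos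

signedMultiples-join : ∀ {m c} u → signedMultiple 1 u ≡ c → ∃ λ p → signedMultiples 1 m (m ∸ 1) p ≡ c
signedMultiples-join {m} u eq = Fin.join m (m ∸ 1) u , trans (cong (signedMultiple 1) (Fin.splitAt-join m (m ∸ 1) u)) eq

magnitude-fromℕ< : ∀ {t n} (t<n : t < n) → suc (toℕ (Fin.fromℕ< t<n)) * 1 ≡ suc t
magnitude-fromℕ< t<n = trans (ℕ.*-identityʳ _) (cong suc (Fin.toℕ-fromℕ< t<n))

signedMultiples-onto : ∀ m .{{_ : NonZero m}} c → InRange m c → c ≢ + 0 →
  ∃ λ p → signedMultiples 1 m (m ∸ 1) p ≡ c
signedMultiples-onto m (+ zero) _ c≢0 = contradiction refl c≢0
signedMultiples-onto m +[1+ t ] (_ , c≤m) _ =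
  signedMultiples-join {m} (inj₁ (Fin.fromℕ< t<m)) (cong +_ (magnitude-fromℕ< t<m))
  where t<m = ℤ.drop‿+≤+ c≤m
signedMultiples-onto m -[1+ t ] (1-m≤c , _) _ =
  signedMultiples-join {m} (inj₂ (Fin.fromℕ< t<m-1)) (cong (ℤ.-_ ∘ +_) (magnitude-fromℕ< t<m-1))
  where t<m-1 = ℤ.drop‿+≤+ (ℤ.neg-cancel-≤ (subst (ℤ._≤ -[1+ t ]) (1-m≡-[m∸1] m) 1-m≤c))

module _ {m t n r : ℕ} .{{_ : NonZero m}} {q : Fin r → ℕ} {S : Fin n → Elt r} (perfect : Perfect m t q S)
         (K : ℕ) .{{_ : NonZero K}} {a b : ℕ} (aK≤m : a * K ≤ m) (bK≤m-1 : b * K ≤ m ∸ 1)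
         (β : Fin r → ℕ) (β∣q : ∀ k → β k ∣ q k) (β∣K : ∀ k → β k ∣ K) where

  private
    W = signedMultiples K a b
    V = signedMultiples 1 m (m ∸ 1)

    W≢0 : ∀ p → W p ≢ + 0
    W≢0 = signedMultiple-≢0 K ∘ splitAt a

    W-injective : Injective _≡_ _≡_ W
    W-injective = Injection.injective (↔⇒↣ (Fin.+↔⊎ {a} {b})) ∘ signedMultiple-injective K

    Wball : Fin (ballSize (a + b) n t) → Vector ℤ n
    Wball = ball W n t

    Wball-coeffs : ∀ i → Coeffs m (Wball i)
    Wball-coeffs = ball-entries W (InRange m) (0-inRange m) (signedMultiple-inRange K aK≤m bK≤m-1 ∘ splitAt a) n t

    K∣Wball : ∀ i k → + K ∣ℤ lin (Wball i) S k
    K∣Wball i = lin-divisible S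
      (ball-entries W (+ K ∣ℤ_) ((+ K) ∣ℤ0) (signedMultiple-divisible K ∘ splitAt a) n t i)

    -- Σ eᵢsᵢ + h, where h ∈ H is given by its coordinates in the box ∏ₖ [0, β k).
    target : Fin (ballSize (a + b) n t) × Fin (∏ β) → Elt r
    target (i , h) k = lin (Wball i) S k ℤ.+ + toℕ (digits β h k)

    target-injective : ∀ {y y'} → target y ≈[ q ] target y' → y ≡ y'
    target-injective {i , h} {i' , h'} y≈y' = cong₂ _,_ i≡i' h≡h'
      where
      coordinate : ∀ k → toℕ (digits β h k) ≡ toℕ (digits β h' k) ×
                         + q k ∣ℤ lin (Wball i) S k ℤ.- lin (Wball i') S k
      coordinate k = shifted-congruence {x = lin (Wball i) S k} {x' = lin (Wball i') S k} (β∣q k)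
        (Signed.∣-trans (∣ᵤ⇒∣ {+ β k} {+ K} (β∣K k)) (Signed.∣m∣n⇒∣m-n (K∣Wball i k) (K∣Wball i' k)))
        (Fin.toℕ<n _) (Fin.toℕ<n _) (∣ᵤ⇒∣ (y≈y' k))
      h≡h' : h ≡ h'
      h≡h' = digits-injective β (λ k → Fin.toℕ-injective (proj₁ (coordinate k)))
      i≡i' : i ≡ i'
      i≡i' = ball-injective W W≢0 W-injective n t
        (packing-injective (proj₁ perfect) (Wball-coeffs i) (Wball-coeffs i')
          (ball-wt W W≢0 n t i) (ball-wt W W≢0 n t i') (λ k → ∣⇒∣ᵤ (proj₂ (coordinate k))))

    represent : ∀ y → ∃ λ i → lin (ball V n t i) S ≈[ q ] target y
    represent y =
      let e , e-coeffs , wt≤t , e≈y = proj₂ perfect (target y)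
          i , ball≗e = ball-complete V (InRange m) (signedMultiples-onto m) n t e e-coeffs wt≤t
      in i , ≈-trans {x = lin (ball V n t i) S} (≈-reflexive (lin-cong S ball≗e)) e≈y

    encode : Fin (ballSize (a + b) n t * ∏ β) → Fin (ballSize (m + (m ∸ 1)) n t)
    encode = proj₁ ∘ represent ∘ remQuot (∏ β)

    encode-injective : Injective _≡_ _≡_ encode
    encode-injective {x} {x'} same = Injection.injective (↔⇒↣ Fin.*↔×) (target-injective y≈y')
      where
      y = remQuot (∏ β) x
      y' = remQuot (∏ β) x'
      y≈y' : target y ≈[ q ] target y'
      y≈y' = ≈-trans {x = target y} (≈-sym {x = lin (ball V n t (encode x)) S} (proj₂ (represent y)))
               (subst (λ i → lin (ball V n t i) S ≈[ q ] target y') (sym same) (proj₂ (represent y')))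

  perfect⇒ballSize-bound : ballSize (a + b) n t * ∏ β ≤ ballSize (m + (m ∸ 1)) n t
  perfect⇒ballSize-bound = Fin.injective⇒≤ encode-injective

lemma12 : (m : ℕ) → 2 ≤ m → (r : ℕ) → (q : Fin r → ℕ) → (∀ k → IsPrimePower (q k)) →
    (n : ℕ) → (S : Fin n → Fin r → ℤ) → Perfect m 2 q S →
    ∀ (j : ℕ) → 1 ≤ j → j ≤ ⌊log₂ m ⌋ →
      sumFrom1 j (λ i → i * mult q (2 ^ i)) ≤ 2 * j + 2
lemma12 m 2≤m r q _ n S perfect j _ j≤log₂m = ^-cancelʳ-≤ 2 (s≤s (s≤s z≤n)) (begin
  2 ^ dyadicRank j q      ≡⟨ 2^dyadicRank≡∏ j q ⟩
  ∏ (dyadicPart j ∘ q)    ≤⟨ ballSize-ratio n 2 (multiples-cover m K K≤m) count ⟩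
  (2 * K) ^ 2             ≡⟨ [2*2^j]²≡2^[2j+2] j ⟩
  2 ^ (2 * j + 2)         ∎)
  where
  open ℕ.≤-Reasoning
  K = 2 ^ j
  1≤m : 1 ≤ m
  1≤m = ℕ.≤-trans (s≤s z≤n) 2≤m
  instance
    m≢0 : NonZero m
    m≢0 = >-nonZero 1≤m
    K≢0 : NonZero K
    K≢0 = ℕ.m^n≢0 2 j
    2K≢0 : NonZero (2 * K)
    2K≢0 = ℕ.m^n≢0 2 (suc j)
  K≤m : K ≤ m
  K≤m = ≤⌊log₂⌋⇒2^≤ j m j≤log₂m 1≤m
  count : ballSize (m / K + (m ∸ 1) / K) n 2 * ∏ (dyadicPart j ∘ q) ≤ ballSize (m + (m ∸ 1)) n 2
  count = perfect⇒ballSize-bound perfect K {m / K} {(m ∸ 1) / K} (m/n*n≤m m K) (m/n*n≤m (m ∸ 1) K)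
            (dyadicPart j ∘ q) (dyadicPart∣ j ∘ q) (dyadicPart∣2^ j ∘ q)
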